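{- Let $(s_n)_{n\ge 0}$ be a sequence over $\mathbb{F}_2$ whose generating function $G(x)=\sum_{n\ge0}s_nx^n\in\mathbb{F}_2[[x]]$ satisfies $h(x,G(x))=0$, where \[ h(x,y)=(x+1)^{2^\ell}\big((a_1x+a_0)y^2+y\big)+f(x)\in\mathbb{F}_2[x,y] \] with an integer $\ell\ge 0$, a polynomial $f\in\mathbb{F}_2[x]$ with $\deg f\le 2^\ell-1$, and $a_0,a_1\in\mathbb{F}_2$ with $(a_1,a_0)\ne(0,0)$. Then \[ C_2(s_n,N)>\frac{N}{2^\ell+2}-2\qquad\text{for all } N\ge 2^{\ell+1}+4 . \]
   Context: For a binary sequence $(s_n)$ over $\mathbb{F}_2=\{0,1\}$, the $N$th correlation measure of order $2$ is \[ C_2(s_n,N)=\max_{M,d_1,d_2}\left|\sum_{n=0}^{M}(-1)^{s_{n+d_1}+s_{n+d_2}}\right|, \] where the maximum is taken over all integers $M\ge 0$ and $0\le d_1<d_2$ with $d_2+M<N$. -}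

module Defs where

open import Data.Bool using (Bool; true; false; _xor_; _∧_)
open import Data.Nat using (ℕ; zero; suc; _+_; _∸_; _^_; _<_; _⊔_)
open import Data.Integer using (ℤ; +_; -[1+_]; ∣_∣)
import Data.Integer as ℤ
open import Data.List using (List; []; _∷_; foldr; map; concatMap; upTo; filter)
open import Relation.Nullary.Decidable using (Dec; yes; no)
import Data.Nat.Properties as ℕP
open import Relation.Binary.PropositionalEquality using (_≡_)

infixl 6 _⊕_
infixl 7 _⊛_
infixl 8 _^ₚ_
infixr 7 _·_

-- F₂ is modelled by Bool: addition = xor, multiplication = ∧.

PS : Set
PS = ℕ → Bool

xsum : ℕ → (ℕ → Bool) → Bool
xsum zero    g = false
xsum (suc n) g = xsum n g xor g n

_⊕_ : PS → PS → PS
(F ⊕ G) n = F n xor G n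

_⊛_ : PS → PS → PS
(F ⊛ G) n = xsum (suc n) (λ i → F i ∧ G (n ∸ i))

constPS : Bool → PS
constPS c zero    = c
constPS c (suc _) = false

X : PS
X (suc zero) = true
X _          = false

onePS : PS
onePS = constPS true

_^ₚ_ : PS → ℕ → PS
F ^ₚ zero  = onePS
F ^ₚ suc k = F ⊛ (F ^ₚ k)

_·_ : Bool → PS → PS
(c · F) n = c ∧ F n

-- A polynomial f ∈ F₂[x] with deg f ≤ d-1, i.e. coefficients vanish from index d on
-- (d = 2^ℓ in the theorem; f = 0 allowed).
DegBelow : PS → ℕ → Set
DegBelow f d = ∀ n → d Data.Nat.≤ n → f n ≡ false

hEval : ℕ → Bool → Bool → PS → PS → PS
hEval ℓ a₁ a₀ f G =
  ((X ⊕ onePS) ^ₚ (2 ^ ℓ)) ⊛ ((((a₁ · X) ⊕ constPS a₀) ⊛ (G ⊛ G)) ⊕ G) ⊕ f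

sgn : Bool → ℤ
sgn false = + 1
sgn true  = ℤ.- (+ 1)

zsum : ℕ → (ℕ → ℤ) → ℤ
zsum zero    g = + 0
zsum (suc k) g = zsum k g ℤ.+ g k

corr : (ℕ → Bool) → ℕ → ℕ → ℕ → ℤ
corr s M d₁ d₂ = zsum (suc M) (λ n → sgn (s (n + d₁) xor s (n + d₂)))

maxList : List ℕ → ℕ
maxList = foldr _⊔_ 0

-- all admissible triples (M, d₁, d₂): M ≥ 0, 0 ≤ d₁ < d₂, d₂ + M < N
-- (enumerated with d₂ < N, d₁ < d₂, M < N ∸ d₂)
C₂ : (ℕ → Bool) → ℕ → ℕ
C₂ s N =
  maxList (concatMap (λ d₂ →
            concatMap (λ d₁ →
              map (λ M → ∣ corr s M d₁ d₂ ∣) (upTo (N ∸ d₂)))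
            (upTo d₂))
          (upTo N))

module Submission where

open import Defs
open import Data.Bool using (Bool; true; false; not; _xor_; _∧_)
open import Data.Bool.Properties
  using ( ∧-comm; ∧-assoc; ∧-zeroʳ; ∧-identityʳ; ∧-idem; ∧-distribˡ-xor
        ; xor-assoc; xor-same; xor-identityʳ; xor-annihilates-not)
open import Data.Nat
  using (ℕ; zero; suc; pred; _+_; _*_; _∸_; _^_; _≤_; _<_; z≤n; s≤s; z<s; NonZero; parity; ⌊_/2⌋)
open import Data.Nat.Properties
open import Data.Nat.DivMod using (_%_; m≡m%n+[m/n]*n; m%n<n) renaming (_/_ to _div_)
open import Data.Nat.Tactic.RingSolver using (solve-∀)
open import Algebra.Properties.CommutativeSemigroup +-commutativeSemigroup using (interchange; x∙yz≈y∙xz)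
open import Data.Parity.Base using (Parity; 0ℙ; 1ℙ) renaming (_+_ to _ℙ+_)
import Data.Parity.Properties as ℙ
open import Data.Product using (∃; _×_; _,_; proj₁; proj₂)
open import Data.Sum using (_⊎_; inj₁; inj₂)
open import Data.Empty using (⊥-elim)
open import Relation.Nullary using (¬_; yes; no)
open import Function using (_∘_)
open import Relation.Binary.PropositionalEquality
open import Data.Integer using (+_; ∣_∣)
import Data.Integer as ℤ
import Data.Integer.Properties as ℤP
open import Data.Integer.Tactic.RingSolver using () renaming (solve-∀ to ℤ-solve-∀)
open import Data.Rational using (_/_; _-_; _>_; toℚᵘ)
import Data.Rational as ℚ
open import Data.Rational.Properties using (toℚᵘ-cancel-<; toℚᵘ-homo-+; toℚᵘ-homo‿-; toℚᵘ-fromℚᵘ)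
open import Data.Rational.Unnormalised using (mkℚᵘ; *<*)
import Data.Rational.Unnormalised as ℚᵘ
import Data.Rational.Unnormalised.Properties as ℚᵘP
open import Data.List using (_∷_)
open import Data.List.Membership.Propositional using (_∈_; lose)
open import Data.List.Membership.Propositional.Properties using (∈-concatMap⁺; ∈-upTo⁺; ∈-map⁺)
open import Data.List.Relation.Unary.Any using (here; there)

-- Put T = 2^ℓ and R = (a₁x + a₀)G² + G. Over F₂ we have (x + 1)^T = 1 + x^T, so h(x, G) = 0 says
-- (1 + x^T) R = f, and deg f < T makes R T-periodic; since G² = G(x²), it also gives the recurrence
-- s(2k) = R(2k) + a₀ s(k), s(2k + 1) = R(2k + 1) + a₁ s(k). Hence for r < 2^j the difference
-- s(x) + s(x + 2^j T) at x = 2^j m + r is a₀^(#0-digits of r) a₁^(#1-digits of r) (s(m) + s(m + T)).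
-- If s(0) + s(T) = a₀K and s(1) + s(1 + T) = a₁K for some K, this difference is the constant a₀a₁K for
-- 1 ≤ x ≤ 2^(j+1) - 2, so the correlation at lags 1 and 1 + 2^j T has absolute value 2^(j+1) - 2;
-- taking 2^j (T + 2) ≤ N < 2^(j+1) (T + 2) gives the bound. Such a K is s(0) + s(T/2) when ℓ > 0 and
-- exists for ℓ = 0 except in one case, where the lags 2^j and 2^(j+1) give a window with a single
-- exceptional term.

xor-cancelˡ : ∀ x y → (x xor y) xor x ≡ y
xor-cancelˡ false y     = xor-identityʳ y
xor-cancelˡ true  false = refl
xor-cancelˡ true  true  = refl

xor≡false⇒≡ : ∀ x y → x xor y ≡ false → x ≡ y
xor≡false⇒≡ false false _ = refl
xor≡false⇒≡ true  true  _ = refl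

xor-common : ∀ r a x y → (r xor (a ∧ x)) xor (r xor (a ∧ y)) ≡ a ∧ (x xor y)
xor-common false a x y = sym (∧-distribˡ-xor a x y)
xor-common true  a x y = trans (xor-annihilates-not (a ∧ x) (a ∧ y)) (sym (∧-distribˡ-xor a x y))

∧≡true : ∀ {x y} → x ∧ y ≡ true → x ≡ true × y ≡ true
∧≡true {true} {true} _ = refl , refl

∧-absorb : ∀ p a b K → (p ≡ true → b ≡ true) → (a ≡ true → b ≡ true → p ≡ true) → p ∧ (a ∧ K) ≡ (a ∧ b) ∧ K
∧-absorb true  a     b     K p⇒b _ rewrite p⇒b refl = cong (_∧ K) (sym (∧-identityʳ a))
∧-absorb false false b     K _   _ = refl
∧-absorb false true  false K _   _ = refl
∧-absorb false true  true  K _   ab⇒p with ab⇒p refl refl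
... | ()

even⊎odd : ∀ n → ∃ (λ k → n ≡ k + k) ⊎ ∃ (λ k → n ≡ suc (k + k))
even⊎odd zero = inj₁ (0 , refl)
even⊎odd (suc n) with even⊎odd n
... | inj₁ (k , refl) = inj₂ (k , refl)
... | inj₂ (k , refl) = inj₁ (suc k , cong suc (sym (+-suc k k)))

2^-suc : ∀ ℓ → 2 ^ suc ℓ ≡ 2 ^ ℓ + 2 ^ ℓ
2^-suc ℓ = cong (λ n → 2 ^ ℓ + n) (+-identityʳ (2 ^ ℓ))

2^-suc-* : ∀ j n → 2 ^ suc j * n ≡ 2 ^ j * n + 2 ^ j * n
2^-suc-* j n = trans (cong (_* n) (2^-suc j)) (*-distribʳ-+ n (2 ^ j) (2 ^ j))

1≤2^ : ∀ ℓ → 1 ≤ 2 ^ ℓ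
1≤2^ ℓ = m^n>0 2 ℓ

parity-even : ∀ k → parity (k + k) ≡ 0ℙ
parity-even k = trans (ℙ.+-homo-+ k k) (ℙ.p+p≡0ℙ (parity k))

parity-odd : ∀ k → parity (suc (k + k)) ≡ 1ℙ
parity-odd k = trans (ℙ.+-homo-+ 1 (k + k)) (cong (1ℙ ℙ+_) (parity-even k))

odd≢even : ∀ k t → suc (k + k) ≢ t + t
odd≢even k t e = ℙ.p≢p⁻¹ 1ℙ (trans (sym (parity-odd k)) (trans (cong parity e) (parity-even t)))

⌊odd/2⌋ : ∀ k → ⌊ suc (k + k) /2⌋ ≡ k
⌊odd/2⌋ zero    = refl
⌊odd/2⌋ (suc k) rewrite +-suc k k = cong suc (⌊odd/2⌋ k)

double-cancel-< : ∀ {k t} → k + k < t + t → k < t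
double-cancel-< {k} {t} lt = ≰⇒> (λ t≤k → <⇒≱ lt (+-mono-≤ t≤k t≤k))

double-cancel-≤ : ∀ {k t} → k + k ≤ suc (t + t) → k ≤ t
double-cancel-≤ {k} {t} le = ≮⇒≥ (λ t<k → <⇒≱ (<-≤-trans (s≤s (+-monoʳ-< t (n<1+n t))) (+-mono-≤ t<k t<k)) le)

double-cancel-≡ : ∀ {k t} → k + k ≡ t + t → k ≡ t
double-cancel-≡ e = ≤-antisym (double-cancel-≤ (m≤n⇒m≤1+n (≤-reflexive e)))
                              (double-cancel-≤ (m≤n⇒m≤1+n (≤-reflexive (sym e))))

dyadic-scale : ∀ A → 0 < A → ∀ N → A ≤ N → ∃ λ i → 2 ^ i * A ≤ N × N < 2 ^ suc i * A
dyadic-scale A 0<A zero    A≤0 = ⊥-elim (<⇒≱ 0<A A≤0)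
dyadic-scale A 0<A (suc N) A≤1+N with m≤n⇒m<n∨m≡n A≤1+N
... | inj₂ refl = 0 , ≤-reflexive (*-identityˡ A) ,
                  subst (A <_) (sym (2^-suc-* 0 A)) (subst (λ n → A < n + n) (sym (*-identityˡ A)) (m<m+n A 0<A))
... | inj₁ (s≤s A≤N) with dyadic-scale A 0<A N A≤N
...   | i , lower , upper with suc N <? 2 ^ suc i * A
...     | yes N+1<upper = i , m≤n⇒m≤1+n lower , N+1<upper
...     | no  N+1≮upper = suc i , ≤-reflexive (sym N+1≡) ,
          subst (suc N <_) (sym (2^-suc-* (suc i) A)) (subst (λ n → suc N < n + n) N+1≡ (m<m+n (suc N) z<s))
  where
  N+1≡ : suc N ≡ 2 ^ suc i * A
  N+1≡ = ≤-antisym upper (≮⇒≥ N+1≮upper)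

exceptional-length : ∀ N p → 3 * p < N → N ≤ 6 * p →
                     ∃ λ L → p ≤ L × L + 1 ≤ 4 * p × (p + p) + L ≤ N × N < L * 3
exceptional-length N zero        3p<N N≤6p = ⊥-elim (<⇒≱ 3p<N N≤6p)
exceptional-length N p@(suc q) 3p<N N≤6p with m≤n⇒m<n∨m≡n N≤6p
... | inj₁ N<6p = L , <⇒≤ p<L , L+1≤4p , ≤-reflexive 2p+L≡N , N<3L
  where
  L = N ∸ (p + p)
  3p≡2p+p : 3 * p ≡ (p + p) + p
  3p≡2p+p = lemma p
    where
    lemma : ∀ p → 3 * p ≡ (p + p) + p
    lemma = solve-∀
  2p+L≡N : (p + p) + L ≡ N
  2p+L≡N = m+[n∸m]≡n (≤-trans (m≤m+n (p + p) p) (subst (_≤ N) 3p≡2p+p (<⇒≤ 3p<N)))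
  p<L : p < L
  p<L = +-cancelˡ-< (p + p) p L (subst₂ _<_ 3p≡2p+p (sym 2p+L≡N) 3p<N)
  L+1≤4p : L + 1 ≤ 4 * p
  L+1≤4p = +-cancelˡ-≤ (p + p) (L + 1) (4 * p)
    (subst₂ _≤_ (trans (+-comm 1 N) (trans (cong (_+ 1) (sym 2p+L≡N)) (+-assoc (p + p) L 1))) (six p) N<6p)
    where
    six : ∀ p → 6 * p ≡ (p + p) + 4 * p
    six = solve-∀
  N<3L : N < L * 3
  N<3L = subst₂ _<_ 2p+L≡N (three L) (+-monoˡ-< L (+-mono-< p<L p<L))
    where
    three : ∀ L → (L + L) + L ≡ L * 3
    three = solve-∀
... | inj₂ refl = L , ≤-trans (m≤m+n p (2 * p)) (m≤m+n (3 * p) q) , ≤-reflexive L+1≡4p , <⇒≤ 2p+L<6p , 6p<3L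
  where
  L = 3 * p + q
  L+1≡4p : L + 1 ≡ 4 * p
  L+1≡4p = lemma q
    where
    lemma : ∀ q → (3 * suc q + q) + 1 ≡ 4 * suc q
    lemma = solve-∀
  2p+L<6p : (p + p) + L < 6 * p
  2p+L<6p = ≤-reflexive (lemma q)
    where
    lemma : ∀ q → suc ((suc q + suc q) + (3 * suc q + q)) ≡ 6 * suc q
    lemma = solve-∀
  6p<3L : 6 * p < L * 3
  6p<3L = subst (6 * p <_) (sym (lemma q)) (m<m+n (6 * p) z<s)
    where
    lemma : ∀ q → (3 * suc q + q) * 3 ≡ 6 * suc q + suc (6 * q + 2)
    lemma = solve-∀

-- Power series over F₂

xsum-unfoldˡ : ∀ n g → xsum (suc n) g ≡ g 0 xor xsum n (g ∘ suc)
xsum-unfoldˡ zero    g = sym (xor-identityʳ (g 0))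
xsum-unfoldˡ (suc n) g = trans (cong (_xor g (suc n)) (xsum-unfoldˡ n g)) (xor-assoc (g 0) _ _)

xsum-palindrome-odd : ∀ k g → (∀ i j → i + j ≡ k + k → g i ≡ g j) → xsum (suc (k + k)) g ≡ g k
xsum-palindrome-odd zero    g sym-g = refl
xsum-palindrome-odd (suc k) g sym-g rewrite +-suc k k = begin
    xsum (suc (suc (k + k))) g xor g n
  ≡⟨ cong (_xor g n) (xsum-unfoldˡ (suc (k + k)) g) ⟩
    (g 0 xor xsum (suc (k + k)) (g ∘ suc)) xor g n
  ≡⟨ cong (λ z → (g 0 xor z) xor g n) (xsum-palindrome-odd k (g ∘ suc) inner) ⟩
    (g 0 xor g (suc k)) xor g n
  ≡⟨ cong (λ z → (z xor g (suc k)) xor g n) (sym-g 0 n refl) ⟩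
    (g n xor g (suc k)) xor g n
  ≡⟨ xor-cancelˡ (g n) (g (suc k)) ⟩
    g (suc k)
  ∎
  where
  open ≡-Reasoning
  n = suc (suc (k + k))
  inner : ∀ i j → i + j ≡ k + k → g (suc i) ≡ g (suc j)
  inner i j e = sym-g (suc i) (suc j) (trans (cong suc (+-suc i j)) (cong (suc ∘ suc) e))

xsum-palindrome-even : ∀ k g → (∀ i j → suc (i + j) ≡ k + k → g i ≡ g j) → xsum (k + k) g ≡ false
xsum-palindrome-even zero    g sym-g = refl
xsum-palindrome-even (suc k) g sym-g rewrite +-suc k k = begin
    xsum (suc (k + k)) g xor g n
  ≡⟨ cong (_xor g n) (xsum-unfoldˡ (k + k) g) ⟩
    (g 0 xor xsum (k + k) (g ∘ suc)) xor g n
  ≡⟨ cong (λ z → (g 0 xor z) xor g n) (xsum-palindrome-even k (g ∘ suc) inner) ⟩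
    (g 0 xor false) xor g n
  ≡⟨ cong (λ z → (z xor false) xor g n) (sym-g 0 n refl) ⟩
    (g n xor false) xor g n
  ≡⟨ cong (_xor g n) (xor-identityʳ (g n)) ⟩
    g n xor g n
  ≡⟨ xor-same (g n) ⟩
    false
  ∎
  where
  open ≡-Reasoning
  n = suc (k + k)
  inner : ∀ i j → suc (i + j) ≡ k + k → g (suc i) ≡ g (suc j)
  inner i j e = sym-g (suc i) (suc j) (trans (cong (suc ∘ suc) (+-suc i j)) (cong (suc ∘ suc) e))

⊛-square-even : ∀ F k → (F ⊛ F) (k + k) ≡ F k
⊛-square-even F k = trans (xsum-palindrome-odd k term palindromic)
                          (trans (cong (λ z → F k ∧ F z) (m+n∸m≡n k k)) (∧-idem (F k)))
  where
  term = λ i → F i ∧ F (k + k ∸ i)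
  palindromic : ∀ i j → i + j ≡ k + k → term i ≡ term j
  palindromic i j e rewrite sym e | m+n∸m≡n i j | m+n∸n≡m i j = ∧-comm (F i) (F j)

⊛-square-odd : ∀ F k → (F ⊛ F) (suc (k + k)) ≡ false
⊛-square-odd F k =
  subst (λ n → xsum n term ≡ false) (+-suc (suc k) k) (xsum-palindrome-even (suc k) term palindromic)
  where
  term = λ i → F i ∧ F (suc (k + k) ∸ i)
  palindromic : ∀ i j → suc (i + j) ≡ suc k + suc k → term i ≡ term j
  palindromic i j e rewrite sym (trans (suc-injective e) (+-suc k k)) | m+n∸m≡n i j | m+n∸n≡m i j =
    ∧-comm (F i) (F j)

TwoTerm : PS → ℕ → Set
TwoTerm F T = ∀ i → i ≢ 0 → i ≢ T → F i ≡ false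

⊛-twoTerm : ∀ F G T → 1 ≤ T → TwoTerm F T → ∀ d → (F ⊛ G) (T + d) ≡ (F 0 ∧ G (T + d)) xor (F T ∧ G d)
⊛-twoTerm F G T@(suc T-1) _ two d =
  trans (sum d) (cong (λ n → (F 0 ∧ G (T + d)) xor (F T ∧ G n)) (m+n∸m≡n T d))
  where
  term = λ i → F i ∧ G (T + d ∸ i)
  vanish : ∀ i → i ≢ 0 → i ≢ T → term i ≡ false
  vanish i i≢0 i≢T rewrite two i i≢0 i≢T = refl
  below : ∀ n → n < T → xsum (suc n) term ≡ term 0
  below zero    _   = refl
  below (suc n) n<T = trans (cong₂ _xor_ (below n (<-trans (n<1+n n) n<T)) (vanish (suc n) (λ ()) (<⇒≢ n<T)))
                            (xor-identityʳ (term 0))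
  sum : ∀ e → xsum (suc (T + e)) term ≡ term 0 xor term T
  sum zero = subst (λ n → xsum (suc n) term ≡ term 0 xor term T) (sym (+-identityʳ T))
                   (cong (_xor term T) (below T-1 ≤-refl))
  sum (suc e) = subst (λ n → xsum (suc n) term ≡ term 0 xor term T) (sym (+-suc T e))
    (trans (cong₂ _xor_ (sum e) (vanish (suc (T + e)) (λ ()) (λ eq → <⇒≢ (s≤s (m≤m+n T e)) (sym eq))))
           (xor-identityʳ _))

binom : ℕ → PS
binom k = (X ⊕ onePS) ^ₚ k

X+1-twoTerm : TwoTerm (X ⊕ onePS) 1
X+1-twoTerm zero          i≢0 _   = ⊥-elim (i≢0 refl)
X+1-twoTerm (suc zero)    _   i≢1 = ⊥-elim (i≢1 refl)
X+1-twoTerm (suc (suc i)) _   _   = refl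

binom-pascal : ∀ k m → binom (suc k) (suc m) ≡ binom k (suc m) xor binom k m
binom-pascal k = ⊛-twoTerm (X ⊕ onePS) (binom k) 1 ≤-refl X+1-twoTerm

binom-pascal² : ∀ k m → binom (2 + k) (2 + m) ≡ binom k (2 + m) xor binom k m
binom-pascal² k m
  rewrite binom-pascal (suc k) (suc m) | binom-pascal k (suc m) | binom-pascal k m =
  xor-telescope (binom k (2 + m)) (binom k (suc m)) (binom k m)
  where
  xor-telescope : ∀ x y z → (x xor y) xor (y xor z) ≡ x xor z
  xor-telescope false y z = trans (sym (xor-assoc y y z)) (cong (_xor z) (xor-same y))
  xor-telescope true  false z = refl
  xor-telescope true  true  false = refl
  xor-telescope true  true  true = refl

binom-zero : ∀ k → binom k 0 ≡ true
binom-zero zero    = refl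
binom-zero (suc k) = binom-zero k

binom-double-even : ∀ k n → binom (k + k) (n + n) ≡ binom k n
binom-double-even zero    zero    = refl
binom-double-even zero    (suc n) = refl
binom-double-even (suc k) zero    rewrite +-suc k k = binom-double-even k 0
binom-double-even (suc k) (suc n)
  rewrite +-suc k k | +-suc n n | binom-pascal² (k + k) (n + n) | binom-pascal k n =
  cong₂ _xor_ (trans (cong (binom (k + k)) (sym (cong suc (+-suc n n)))) (binom-double-even k (suc n)))
              (binom-double-even k n)

binom-double-odd : ∀ k n → binom (k + k) (suc (n + n)) ≡ false
binom-double-odd zero    n = refl
binom-double-odd (suc k) zero rewrite +-suc k k | binom-pascal (suc (k + k)) 0 | binom-pascal (k + k) 0 =
  trans (xor-assoc (binom (k + k) 1) (binom (k + k) 0) (binom (k + k) 0))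
        (trans (cong (binom (k + k) 1 xor_) (xor-same (binom (k + k) 0)))
               (trans (xor-identityʳ _) (binom-double-odd k 0)))
binom-double-odd (suc k) (suc n) rewrite +-suc k k | +-suc n n | binom-pascal² (k + k) (suc (n + n)) =
  cong₂ _xor_ (trans (cong (λ m → binom (k + k) (suc m)) (sym (cong suc (+-suc n n))))
                     (binom-double-odd k (suc n)))
              (binom-double-odd k n)

binom-2^-diagonal : ∀ ℓ → binom (2 ^ ℓ) (2 ^ ℓ) ≡ true
binom-2^-diagonal zero    = refl
binom-2^-diagonal (suc ℓ) rewrite 2^-suc ℓ = trans (binom-double-even (2 ^ ℓ) (2 ^ ℓ)) (binom-2^-diagonal ℓ)

binom-2^-twoTerm : ∀ ℓ → TwoTerm (binom (2 ^ ℓ)) (2 ^ ℓ)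
binom-2^-twoTerm zero    zero          i≢0 _   = ⊥-elim (i≢0 refl)
binom-2^-twoTerm zero    (suc zero)    _   i≢1 = ⊥-elim (i≢1 refl)
binom-2^-twoTerm zero    (suc (suc i)) _   _   = binom-pascal 0 (suc i)
binom-2^-twoTerm (suc ℓ) i i≢0 i≢T rewrite 2^-suc ℓ with even⊎odd i
... | inj₁ (k , refl) = trans (binom-double-even (2 ^ ℓ) k)
                              (binom-2^-twoTerm ℓ k (λ { refl → i≢0 refl }) (λ { refl → i≢T refl }))
... | inj₂ (k , refl) = binom-double-odd (2 ^ ℓ) k

module Recurrence (s : ℕ → Bool) (ℓ : ℕ) (f : PS) (a₁ a₀ : Bool)
                  (deg-f : DegBelow f (2 ^ ℓ)) (root : ∀ n → hEval ℓ a₁ a₀ f s n ≡ false) where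

  T : ℕ
  T = 2 ^ ℓ

  linear : PS
  linear = (a₁ · X) ⊕ constPS a₀

  R : PS
  R = (linear ⊛ (s ⊛ s)) ⊕ s

  R-periodic : ∀ d → R (T + d) ≡ R d
  R-periodic d = xor≡false⇒≡ (R (T + d)) (R d) (begin
      R (T + d) xor R d
    ≡⟨ cong₂ (λ x y → (x ∧ R (T + d)) xor (y ∧ R d)) (sym (binom-zero T)) (sym (binom-2^-diagonal ℓ)) ⟩
      (binom T 0 ∧ R (T + d)) xor (binom T T ∧ R d)
    ≡⟨ sym (⊛-twoTerm (binom T) R T (1≤2^ ℓ) (binom-2^-twoTerm ℓ) d) ⟩
      (binom T ⊛ R) (T + d)
    ≡⟨ sym (xor-identityʳ _) ⟩
      (binom T ⊛ R) (T + d) xor false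
    ≡⟨ cong ((binom T ⊛ R) (T + d) xor_) (sym (deg-f (T + d) (m≤m+n T d))) ⟩
      hEval ℓ a₁ a₀ f s (T + d)
    ≡⟨ root (T + d) ⟩
      false
    ∎)
    where open ≡-Reasoning

  linear-0 : linear 0 ≡ a₀
  linear-0 = cong (_xor a₀) (∧-zeroʳ a₁)

  linear-1 : linear 1 ≡ a₁
  linear-1 = trans (xor-identityʳ _) (∧-identityʳ a₁)

  linear-twoTerm : TwoTerm linear 1
  linear-twoTerm zero          i≢0 _   = ⊥-elim (i≢0 refl)
  linear-twoTerm (suc zero)    _   i≢1 = ⊥-elim (i≢1 refl)
  linear-twoTerm (suc (suc i)) _   _   = trans (xor-identityʳ _) (∧-zeroʳ a₁)

  linear-⊛-suc : ∀ F m → (linear ⊛ F) (suc m) ≡ (a₀ ∧ F (suc m)) xor (a₁ ∧ F m)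
  linear-⊛-suc F m = trans (⊛-twoTerm linear F 1 ≤-refl linear-twoTerm m)
                           (cong₂ (λ x y → (x ∧ F (suc m)) xor (y ∧ F m)) linear-0 linear-1)

  linear-⊛-square-even : ∀ k → (linear ⊛ (s ⊛ s)) (k + k) ≡ a₀ ∧ s k
  linear-⊛-square-even zero    = cong₂ _∧_ linear-0 (⊛-square-even s 0)
  linear-⊛-square-even (suc k) rewrite +-suc k k = begin
      (linear ⊛ (s ⊛ s)) (suc (suc (k + k)))
    ≡⟨ linear-⊛-suc (s ⊛ s) (suc (k + k)) ⟩
      (a₀ ∧ (s ⊛ s) (suc (suc (k + k)))) xor (a₁ ∧ (s ⊛ s) (suc (k + k)))
    ≡⟨ cong₂ (λ x y → (a₀ ∧ x) xor (a₁ ∧ y))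
             (trans (cong (s ⊛ s) (sym (cong suc (+-suc k k)))) (⊛-square-even s (suc k)))
             (⊛-square-odd s k) ⟩
      (a₀ ∧ s (suc k)) xor (a₁ ∧ false)
    ≡⟨ trans (cong ((a₀ ∧ s (suc k)) xor_) (∧-zeroʳ a₁)) (xor-identityʳ _) ⟩
      a₀ ∧ s (suc k)
    ∎
    where open ≡-Reasoning

  linear-⊛-square-odd : ∀ k → (linear ⊛ (s ⊛ s)) (suc (k + k)) ≡ a₁ ∧ s k
  linear-⊛-square-odd k = begin
      (linear ⊛ (s ⊛ s)) (suc (k + k))
    ≡⟨ linear-⊛-suc (s ⊛ s) (k + k) ⟩
      (a₀ ∧ (s ⊛ s) (suc (k + k))) xor (a₁ ∧ (s ⊛ s) (k + k))
    ≡⟨ cong₂ (λ x y → (a₀ ∧ x) xor (a₁ ∧ y)) (⊛-square-odd s k) (⊛-square-even s k) ⟩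
      (a₀ ∧ false) xor (a₁ ∧ s k)
    ≡⟨ cong (_xor (a₁ ∧ s k)) (∧-zeroʳ a₀) ⟩
      a₁ ∧ s k
    ∎
    where open ≡-Reasoning

  s-even : ∀ k → s (k + k) ≡ R (k + k) xor (a₀ ∧ s k)
  s-even k rewrite linear-⊛-square-even k = sym (xor-cancelˡ (a₀ ∧ s k) (s (k + k)))

  s-odd : ∀ k → s (suc (k + k)) ≡ R (suc (k + k)) xor (a₁ ∧ s k)
  s-odd k rewrite linear-⊛-square-odd k = sym (xor-cancelˡ (a₁ ∧ s k) (s (suc (k + k))))

-- Digit products

module Digits (a₀ a₁ : Bool) where

  digit : Parity → Bool
  digit 0ℙ = a₀
  digit 1ℙ = a₁

  digitProduct : ℕ → ℕ → Bool
  digitProduct zero    r = true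
  digitProduct (suc j) r = digit (parity r) ∧ digitProduct j ⌊ r /2⌋

  digitProduct-even : ∀ j k → digitProduct (suc j) (k + k) ≡ a₀ ∧ digitProduct j k
  digitProduct-even j k = cong₂ (λ p q → digit p ∧ digitProduct j q) (parity-even k) (sym (n≡⌊n+n/2⌋ k))

  digitProduct-odd : ∀ j k → digitProduct (suc j) (suc (k + k)) ≡ a₁ ∧ digitProduct j k
  digitProduct-odd j k = cong₂ (λ p q → digit p ∧ digitProduct j q) (parity-odd k) (⌊odd/2⌋ k)

  digitProduct-true : a₀ ≡ true → a₁ ≡ true → ∀ j r → digitProduct j r ≡ true
  digitProduct-true a₀≡t a₁≡t zero    r = refl
  digitProduct-true a₀≡t a₁≡t (suc j) r =
    cong₂ _∧_ (digit-true (parity r)) (digitProduct-true a₀≡t a₁≡t j ⌊ r /2⌋)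
    where
    digit-true : ∀ p → digit p ≡ true
    digit-true 0ℙ = a₀≡t
    digit-true 1ℙ = a₁≡t

  digitProduct⇒a₁ : ∀ j r → 0 < r → r < 2 ^ j → digitProduct j r ≡ true → a₁ ≡ true
  digitProduct⇒a₁ zero    (suc r) _ (s≤s ()) _
  digitProduct⇒a₁ (suc j) r 0<r r<2^j+1 Π≡t with even⊎odd r
  ... | inj₁ (zero  , refl) = ⊥-elim (<-irrefl refl 0<r)
  ... | inj₁ (suc k , refl) =
    digitProduct⇒a₁ j (suc k) (s≤s z≤n) (double-cancel-< (subst (suc k + suc k <_) (2^-suc j) r<2^j+1))
      (proj₂ (∧≡true (trans (sym (digitProduct-even j (suc k))) Π≡t)))
  ... | inj₂ (k , refl) = proj₁ (∧≡true (trans (sym (digitProduct-odd j k)) Π≡t))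

  digitProduct⇒a₀ : ∀ j r → 2 + r ≤ 2 ^ j → digitProduct j r ≡ true → a₀ ≡ true
  digitProduct⇒a₀ zero    r (s≤s ()) _
  digitProduct⇒a₀ (suc j) r 2+r≤2^j+1 Π≡t with even⊎odd r
  ... | inj₁ (k , refl) = proj₁ (∧≡true (trans (sym (digitProduct-even j k)) Π≡t))
  ... | inj₂ (k , refl) =
    digitProduct⇒a₀ j k (double-cancel-≤ (subst (_≤ suc (2 ^ j + 2 ^ j)) (sym double-2+k)
                                                 (s≤s (subst (3 + (k + k) ≤_) (2^-suc j) 2+r≤2^j+1))))
      (proj₂ (∧≡true (trans (sym (digitProduct-odd j k)) Π≡t)))
    where
    double-2+k : (2 + k) + (2 + k) ≡ suc (3 + (k + k))
    double-2+k = cong (suc ∘ suc) (trans (+-suc k (suc k)) (cong suc (+-suc k k)))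

  digitProduct-ones : a₁ ≡ true → ∀ j r → suc r ≡ 2 ^ j → digitProduct j r ≡ true
  digitProduct-ones a₁≡t zero    zero    _ = refl
  digitProduct-ones a₁≡t (suc j) r e with even⊎odd r
  ... | inj₁ (k , refl) = ⊥-elim (odd≢even k (2 ^ j) (trans e (2^-suc j)))
  ... | inj₂ (k , refl) = trans (digitProduct-odd j k)
    (cong₂ _∧_ a₁≡t (digitProduct-ones a₁≡t j k
      (double-cancel-≡ (trans (cong suc (+-suc k k)) (trans e (2^-suc j))))))

-- Correlation sums

maxList-≥ : ∀ {x xs} → x ∈ xs → x ≤ maxList xs
maxList-≥ (here refl)         = m≤m⊔n _ _
maxList-≥ {xs = y ∷ _} (there x∈xs) = ≤-trans (maxList-≥ x∈xs) (m≤n⊔m y _)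

corr≤C₂ : ∀ s N M d₁ d₂ → d₁ < d₂ → d₂ + M < N → ∣ corr s M d₁ d₂ ∣ ≤ C₂ s N
corr≤C₂ s N M d₁ d₂ d₁<d₂ d₂+M<N =
  maxList-≥ (∈-concatMap⁺ _ (lose (∈-upTo⁺ d₂<N)
              (∈-concatMap⁺ _ (lose (∈-upTo⁺ d₁<d₂)
                (∈-map⁺ (λ M → ∣ corr s M d₁ d₂ ∣) (∈-upTo⁺ M<N∸d₂))))))
  where
  d₂<N : d₂ < N
  d₂<N = ≤-<-trans (m≤m+n d₂ M) d₂+M<N
  M<N∸d₂ : M < N ∸ d₂
  M<N∸d₂ = m+n≤o⇒m≤o∸n (suc M) (subst (_≤ N) (cong suc (+-comm d₂ M)) d₂+M<N)

zsum-sgn-constant : ∀ k b v → (∀ n → n < k → b n ≡ v) → zsum k (sgn ∘ b) ≡ + k ℤ.* sgn v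
zsum-sgn-constant zero    b v _   = refl
zsum-sgn-constant (suc k) b v b≡v = begin
    zsum k (sgn ∘ b) ℤ.+ sgn (b k)
  ≡⟨ cong₂ ℤ._+_ (zsum-sgn-constant k b v (λ n n<k → b≡v n (m<n⇒m<1+n n<k))) (cong sgn (b≡v k ≤-refl)) ⟩
    + k ℤ.* sgn v ℤ.+ sgn v
  ≡⟨ one+-* (+ k) (sgn v) ⟩
    (+ 1 ℤ.+ + k) ℤ.* sgn v
  ∎
  where
  open ≡-Reasoning
  one+-* : ∀ x z → x ℤ.* z ℤ.+ z ≡ (+ 1 ℤ.+ x) ℤ.* z
  one+-* = ℤ-solve-∀

∣corr∣-constant : ∀ s M d₁ d₂ v → (∀ n → n ≤ M → s (n + d₁) xor s (n + d₂) ≡ v) → ∣ corr s M d₁ d₂ ∣ ≡ suc M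
∣corr∣-constant s M d₁ d₂ v const = begin
    ∣ zsum (suc M) (sgn ∘ b) ∣
  ≡⟨ cong ∣_∣ (zsum-sgn-constant (suc M) b v (λ n n<1+M → const n (≤-pred n<1+M))) ⟩
    ∣ + suc M ℤ.* sgn v ∣
  ≡⟨ ℤP.abs-* (+ suc M) (sgn v) ⟩
    suc M * ∣ sgn v ∣
  ≡⟨ trans (cong (suc M *_) (∣sgn∣ v)) (*-identityʳ (suc M)) ⟩
    suc M
  ∎
  where
  open ≡-Reasoning
  b = λ n → s (n + d₁) xor s (n + d₂)
  ∣sgn∣ : ∀ x → ∣ sgn x ∣ ≡ 1
  ∣sgn∣ false = refl
  ∣sgn∣ true  = refl

zsum-sgn-one-exception : ∀ k a b → a < k → b a ≡ true → (∀ n → n < k → n ≢ a → b n ≡ false) →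
                         zsum k (sgn ∘ b) ℤ.+ + 2 ≡ + k
zsum-sgn-one-exception (suc k) a b a<1+k ba others with k ≟ a
... | yes refl = begin
    (zsum k (sgn ∘ b) ℤ.+ sgn (b k)) ℤ.+ + 2
  ≡⟨ cong₂ (λ x y → (x ℤ.+ sgn y) ℤ.+ + 2) (zsum-sgn-constant k b false below) ba ⟩
    (+ k ℤ.* + 1 ℤ.+ ℤ.- + 1) ℤ.+ + 2
  ≡⟨ minus-one-plus-two (+ k) ⟩
    + k ℤ.+ + 1
  ≡⟨ cong +_ (+-comm k 1) ⟩
    + suc k
  ∎
  where
  open ≡-Reasoning
  below : ∀ n → n < k → b n ≡ false
  below n n<k = others n (m<n⇒m<1+n n<k) (<⇒≢ n<k)
  minus-one-plus-two : ∀ x → (x ℤ.* + 1 ℤ.+ ℤ.- + 1) ℤ.+ + 2 ≡ x ℤ.+ + 1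
  minus-one-plus-two = ℤ-solve-∀
... | no k≢a = begin
    (zsum k (sgn ∘ b) ℤ.+ sgn (b k)) ℤ.+ + 2
  ≡⟨ swap (zsum k (sgn ∘ b)) (sgn (b k)) ⟩
    (zsum k (sgn ∘ b) ℤ.+ + 2) ℤ.+ sgn (b k)
  ≡⟨ cong₂ (λ x y → x ℤ.+ sgn y) (zsum-sgn-one-exception k a b a<k ba (λ n n<k → others n (m<n⇒m<1+n n<k)))
                                (others k ≤-refl k≢a) ⟩
    + k ℤ.+ + 1
  ≡⟨ cong +_ (+-comm k 1) ⟩
    + suc k
  ∎
  where
  open ≡-Reasoning
  a<k : a < k
  a<k = ≤∧≢⇒< (≤-pred a<1+k) (k≢a ∘ sym)
  swap : ∀ x y → (x ℤ.+ y) ℤ.+ + 2 ≡ (x ℤ.+ + 2) ℤ.+ y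
  swap = ℤ-solve-∀

z+2≡k⇒k∸2≤∣z∣ : ∀ z k → z ℤ.+ + 2 ≡ + k → k ∸ 2 ≤ ∣ z ∣
z+2≡k⇒k∸2≤∣z∣ z zero          _ = z≤n
z+2≡k⇒k∸2≤∣z∣ z (suc zero)    _ = z≤n
z+2≡k⇒k∸2≤∣z∣ z (suc (suc m)) e = ≤-reflexive (sym (cong ∣_∣ (trans (minus-two z) (cong (ℤ._- + 2) e))))
  where
  minus-two : ∀ x → x ≡ (x ℤ.+ + 2) ℤ.- + 2
  minus-two = ℤ-solve-∀

ℚ-lower-bound : ∀ C N D → N < (C + 2) * suc D → (+ C / 1) > ((+ N / suc D) - (+ 2 / 1))
ℚ-lower-bound C N D N<[C+2][D+1] = toℚᵘ-cancel-< (ℚᵘP.<-respʳ-≃ (ℚᵘP.≃-sym (toℚᵘ-fromℚᵘ (mkℚᵘ (+ C) 0)))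
                                                 (ℚᵘP.<-respˡ-≃ (ℚᵘP.≃-sym lhs≃) (*<* cross)))
  where
  lhs≃ : toℚᵘ ((+ N / suc D) - (+ 2 / 1)) ℚᵘ.≃ (mkℚᵘ (+ N) D ℚᵘ.+ ℚᵘ.- mkℚᵘ (+ 2) 0)
  lhs≃ = ℚᵘP.≃-trans (toℚᵘ-homo-+ (+ N / suc D) (ℚ.- (+ 2 / 1)))
           (ℚᵘP.+-cong (toℚᵘ-fromℚᵘ (mkℚᵘ (+ N) D))
                        (ℚᵘP.≃-trans (toℚᵘ-homo‿- (+ 2 / 1)) (ℚᵘP.-‿cong (toℚᵘ-fromℚᵘ (mkℚᵘ (+ 2) 0)))))
  -- N/(D+1) - 2 < C cross-multiplied, in the literal unnormalised form that *<* expects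
  cross : (+ N ℤ.* + 1 ℤ.+ ℤ.- (+ 2) ℤ.* + suc D) ℤ.* + 1 ℤ.< + C ℤ.* + suc (D * 1)
  cross = subst₂ ℤ._<_ (sym (lhs-form (+ N) d))
                       (trans (rhs-form (+ C) d) (cong (λ n → + C ℤ.* + suc n) (sym (*-identityʳ D))))
                       (ℤP.+-monoˡ-< (ℤ.- (+ 2 ℤ.* d)) (subst (+ N ℤ.<_) expand (ℤ.+<+ N<[C+2][D+1])))
    where
    d = + suc D
    expand : + ((C + 2) * suc D) ≡ + C ℤ.* d ℤ.+ + 2 ℤ.* d
    expand = trans (ℤP.pos-* (C + 2) (suc D))
                   (trans (cong (ℤ._* d) (ℤP.pos-+ C 2)) (ℤP.*-distribʳ-+ d (+ C) (+ 2)))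
    lhs-form : ∀ n d → (n ℤ.* + 1 ℤ.+ ℤ.- (+ 2) ℤ.* d) ℤ.* + 1 ≡ n ℤ.+ ℤ.- (+ 2 ℤ.* d)
    lhs-form = ℤ-solve-∀
    rhs-form : ∀ c d → (c ℤ.* d ℤ.+ + 2 ℤ.* d) ℤ.+ ℤ.- (+ 2 ℤ.* d) ≡ c ℤ.* d
    rhs-form = ℤ-solve-∀

-- Windows along dyadic shifts

module Dyadic (s R : ℕ → Bool) (a₀ a₁ : Bool) (T : ℕ)
              (s-even : ∀ k → s (k + k) ≡ R (k + k) xor (a₀ ∧ s k))
              (s-odd : ∀ k → s (suc (k + k)) ≡ R (suc (k + k)) xor (a₁ ∧ s k))
              (R-periodic : ∀ d → R (T + d) ≡ R d) where

  open Digits a₀ a₁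

  diff : ℕ → ℕ → Bool
  diff E x = s x xor s (x + E)

  Period : ℕ → Set
  Period D = ∀ m → R (m + D) ≡ R m

  Period-double : ∀ {D} → Period D → Period (D + D)
  Period-double {D} per m = trans (cong R (sym (+-assoc m D D))) (trans (per (m + D)) (per m))

  Period-dyadic : ∀ j → Period (2 ^ j * T)
  Period-dyadic zero    m =
    trans (cong (λ D → R (m + D)) (*-identityˡ T)) (trans (cong R (+-comm m T)) (R-periodic m))
  Period-dyadic (suc j) m = trans (cong (λ D → R (m + D)) (2^-suc-* j T)) (Period-double (Period-dyadic j) m)

  diff-double : ∀ D → Period (D + D) → ∀ k →
                diff (D + D) (k + k) ≡ a₀ ∧ diff D k × diff (D + D) (suc (k + k)) ≡ a₁ ∧ diff D k
  diff-double D per k = step (interchange k k D D) (s-even k) (s-even (k + D)) ,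
                        step (cong suc (interchange k k D D)) (s-odd k) (s-odd (k + D))
    where
    step : ∀ {a x y} → x + (D + D) ≡ y → s x ≡ R x xor (a ∧ s k) → s y ≡ R y xor (a ∧ s (k + D)) →
           diff (D + D) x ≡ a ∧ diff D k
    step {a} {x} {y} e sx sy = begin
        s x xor s (x + (D + D))
      ≡⟨ cong₂ _xor_ sx (trans (cong s e) sy) ⟩
        (R x xor (a ∧ s k)) xor (R y xor (a ∧ s (k + D)))
      ≡⟨ cong (λ r → (R x xor (a ∧ s k)) xor (r xor (a ∧ s (k + D)))) (trans (cong R (sym e)) (per x)) ⟩
        (R x xor (a ∧ s k)) xor (R x xor (a ∧ s (k + D)))
      ≡⟨ xor-common (R x) a (s k) (s (k + D)) ⟩
        a ∧ diff D k
      ∎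
      where open ≡-Reasoning

  diff-dyadic : ∀ j m r → r < 2 ^ j → diff (2 ^ j * T) (2 ^ j * m + r) ≡ digitProduct j r ∧ diff T m
  diff-dyadic zero    m zero    _ = cong₂ diff (*-identityˡ T) (trans (+-identityʳ (1 * m)) (*-identityˡ m))
  diff-dyadic zero    m (suc r) (s≤s ())
  diff-dyadic (suc j) m r r<2^j+1 with even⊎odd r
  ... | inj₁ (k , refl) = begin
      diff (2 ^ suc j * T) (2 ^ suc j * m + (k + k))
    ≡⟨ cong₂ diff (2^-suc-* j T) (trans (cong (_+ (k + k)) (2^-suc-* j m)) (interchange y y k k)) ⟩
      diff (E + E) (x + x)
    ≡⟨ proj₁ (diff-double E (Period-double (Period-dyadic j)) x) ⟩
      a₀ ∧ diff E x
    ≡⟨ cong (a₀ ∧_) (diff-dyadic j m k (double-cancel-< (subst (k + k <_) (2^-suc j) r<2^j+1))) ⟩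
      a₀ ∧ (digitProduct j k ∧ diff T m)
    ≡⟨ sym (trans (cong (_∧ diff T m) (digitProduct-even j k)) (∧-assoc a₀ _ _)) ⟩
      digitProduct (suc j) (k + k) ∧ diff T m
    ∎
    where
    open ≡-Reasoning
    E = 2 ^ j * T
    y = 2 ^ j * m
    x = y + k
  ... | inj₂ (k , refl) = begin
      diff (2 ^ suc j * T) (2 ^ suc j * m + suc (k + k))
    ≡⟨ cong₂ diff (2^-suc-* j T) (trans (cong (_+ suc (k + k)) (2^-suc-* j m))
                                        (trans (+-suc _ (k + k)) (cong suc (interchange y y k k)))) ⟩
      diff (E + E) (suc (x + x))
    ≡⟨ proj₂ (diff-double E (Period-double (Period-dyadic j)) x) ⟩
      a₁ ∧ diff E x
    ≡⟨ cong (a₁ ∧_) (diff-dyadic j m k k<2^j) ⟩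
      a₁ ∧ (digitProduct j k ∧ diff T m)
    ≡⟨ sym (trans (cong (_∧ diff T m) (digitProduct-odd j k)) (∧-assoc a₁ _ _)) ⟩
      digitProduct (suc j) (suc (k + k)) ∧ diff T m
    ∎
    where
    open ≡-Reasoning
    E = 2 ^ j * T
    y = 2 ^ j * m
    x = y + k
    k<2^j : k < 2 ^ j
    k<2^j = double-cancel-< (<-trans (n<1+n (k + k)) (subst (suc (k + k) <_) (2^-suc j) r<2^j+1))

  -- If x < 2^j, then x > 0 has a binary digit 1; otherwise x - 2^j ≤ 2^j - 2 has a digit 0 among its
  -- last j. Either way the digit product times a₀K, resp. a₁K, is a₀a₁K.
  diff-window : ∀ K → diff T 0 ≡ a₀ ∧ K → diff T 1 ≡ a₁ ∧ K →
                ∀ j x → 0 < x → 2 + x ≤ 2 ^ suc j → diff (2 ^ j * T) x ≡ (a₀ ∧ a₁) ∧ K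
  diff-window K diff₀ diff₁ j x 0<x 2+x≤ with x <? 2 ^ j
  ... | yes x<2^j = begin
      diff (2 ^ j * T) x
    ≡⟨ cong (diff (2 ^ j * T)) (sym (cong (_+ x) (*-zeroʳ (2 ^ j)))) ⟩
      diff (2 ^ j * T) (2 ^ j * 0 + x)
    ≡⟨ diff-dyadic j 0 x x<2^j ⟩
      digitProduct j x ∧ diff T 0
    ≡⟨ cong (digitProduct j x ∧_) diff₀ ⟩
      digitProduct j x ∧ (a₀ ∧ K)
    ≡⟨ ∧-absorb (digitProduct j x) a₀ a₁ K (digitProduct⇒a₁ j x 0<x x<2^j)
                (λ a₀≡t a₁≡t → digitProduct-true a₀≡t a₁≡t j x) ⟩
      (a₀ ∧ a₁) ∧ K
    ∎
    where open ≡-Reasoning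
  ... | no x≮2^j = begin
      diff (2 ^ j * T) x
    ≡⟨ cong (diff (2 ^ j * T)) (sym (trans (cong (_+ r) (*-identityʳ t)) x≡t+r)) ⟩
      diff (2 ^ j * T) (2 ^ j * 1 + r)
    ≡⟨ diff-dyadic j 1 r (≤-trans (n≤1+n (suc r)) 2+r≤t) ⟩
      digitProduct j r ∧ diff T 1
    ≡⟨ cong (digitProduct j r ∧_) diff₁ ⟩
      digitProduct j r ∧ (a₁ ∧ K)
    ≡⟨ ∧-absorb (digitProduct j r) a₁ a₀ K (digitProduct⇒a₀ j r 2+r≤t)
                (λ a₁≡t a₀≡t → digitProduct-true a₀≡t a₁≡t j r) ⟩
      (a₁ ∧ a₀) ∧ K
    ≡⟨ cong (_∧ K) (∧-comm a₁ a₀) ⟩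
      (a₀ ∧ a₁) ∧ K
    ∎
    where
    open ≡-Reasoning
    t = 2 ^ j
    r = x ∸ t
    x≡t+r : t + r ≡ x
    x≡t+r = m+[n∸m]≡n (≮⇒≥ x≮2^j)
    2+r≤t : 2 + r ≤ t
    2+r≤t = +-cancelˡ-≤ t (2 + r) t
      (subst₂ _≤_ (trans (cong (λ n → 2 + n) (sym x≡t+r)) (x∙yz≈y∙xz 2 t r)) (2^-suc j) 2+x≤)

  C₂-window-bound : ∀ K → diff T 0 ≡ a₀ ∧ K → diff T 1 ≡ a₁ ∧ K → 0 < T →
                    ∀ N j → 2 ^ suc j * (2 + T) ≤ N → 2 ^ suc (suc j) ≤ C₂ s N + 2
  C₂-window-bound K diff₀ diff₁ 0<T N j lower = begin
    2 ^ suc i                   ≡⟨ sym M+3≡q ⟩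
    M + 3                       ≡⟨ +-suc M 2 ⟩
    suc M + 2                   ≡⟨ cong (_+ 2) (sym (∣corr∣-constant s M 1 (1 + E) _ window)) ⟩
    ∣ corr s M 1 (1 + E) ∣ + 2  ≤⟨ +-monoˡ-≤ 2 (corr≤C₂ s N M 1 (1 + E) 1<1+E d₂+M<N) ⟩
    C₂ s N + 2                  ∎
    where
    open ≤-Reasoning
    i = suc j
    E = 2 ^ i * T
    q = 2 ^ suc i
    M = q ∸ 3
    M+3≡q : M + 3 ≡ q
    M+3≡q = m∸n+n≡m (≤-trans (n≤1+n 3) (*-monoʳ-≤ 2 (*-monoʳ-≤ 2 (1≤2^ j))))
    1<1+E : 1 < 1 + E
    1<1+E = s≤s (*-mono-≤ (1≤2^ i) 0<T)
    d₂+M<N : (1 + E) + M < N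
    d₂+M<N = ≤-trans (≤-trans (n≤1+n _) (≤-reflexive (trans (shift E M) (cong (_+ E) M+3≡q))))
                     (subst (_≤ N) (split (2 ^ i) T) lower)
      where
      shift : ∀ E M → suc (suc ((1 + E) + M)) ≡ (M + 3) + E
      shift = solve-∀
      split : ∀ p T → p * (2 + T) ≡ 2 * p + p * T
      split = solve-∀
    window : ∀ n → n ≤ M → s (n + 1) xor s (n + (1 + E)) ≡ (a₀ ∧ a₁) ∧ K
    window n n≤M = trans (cong (λ m → s (n + 1) xor s m) (sym (+-assoc n 1 E)))
                         (diff-window K diff₀ diff₁ i (n + 1) (m≤n+m 1 n) 2+[n+1]≤q)
      where
      2+[n+1]≤q : 2 + (n + 1) ≤ q
      2+[n+1]≤q = subst₂ _≤_ (trans (+-comm n 3) (cong (λ m → 2 + m) (+-comm 1 n))) M+3≡q (+-monoˡ-≤ 3 n≤M)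

  C₂-generic : ∀ K → diff T 0 ≡ a₀ ∧ K → diff T 1 ≡ a₁ ∧ K → 0 < T →
               ∀ N → 2 * (2 + T) ≤ N → N < (C₂ s N + 2) * (2 + T)
  C₂-generic K diff₀ diff₁ 0<T N 2[2+T]≤N with dyadic-scale (2 + T) z<s N (≤-trans (m≤m+n (2 + T) _) 2[2+T]≤N)
  ... | zero  , _     , upper = ⊥-elim (<⇒≱ upper 2[2+T]≤N)
  ... | suc j , lower , upper =
    <-≤-trans upper (*-monoˡ-≤ (2 + T) (C₂-window-bound K diff₀ diff₁ 0<T N j lower))

-- The case ℓ = 0, a₀ = 0, a₁ = 1, s₀ = 1, where s = 1 0 1 1 1 0 1 0 … and diff-window does not apply
-- (diff 1 0 = 1 but a₀ = 0). The correlation of the lags p = 2^j and 2p instead has exactly one term -1.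
module Exceptional (s R : ℕ → Bool)
                   (s-even : ∀ k → s (k + k) ≡ R (k + k) xor (false ∧ s k))
                   (s-odd : ∀ k → s (suc (k + k)) ≡ R (suc (k + k)) xor (true ∧ s k))
                   (R-periodic : ∀ d → R (1 + d) ≡ R d) (R₀ : R 0 ≡ true) where

  open Dyadic s R false true 1 s-even s-odd R-periodic
  open Digits false true

  R-true : ∀ n → R n ≡ true
  R-true zero    = R₀
  R-true (suc n) = trans (R-periodic n) (R-true n)

  s-even-true : ∀ k → s (k + k) ≡ true
  s-even-true k = trans (s-even k) (cong (_xor false) (R-true (k + k)))

  s-odd-not : ∀ k → s (suc (k + k)) ≡ not (s k)
  s-odd-not k = trans (s-odd k) (cong (_xor s k) (R-true (suc (k + k))))

  s-1 : s 1 ≡ false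
  s-1 = trans (s-odd-not 0) (cong not (s-even-true 0))

  s-3 : s 3 ≡ true
  s-3 = trans (s-odd-not 1) (cong not s-1)

  diff-1-1 : diff 1 1 ≡ true
  diff-1-1 = cong₂ _xor_ s-1 (s-even-true 1)

  diff-1-2 : diff 1 2 ≡ false
  diff-1-2 = cong₂ _xor_ (s-even-true 1) s-3

  diff-1-3 : diff 1 3 ≡ false
  diff-1-3 = cong₂ _xor_ s-3 (s-even-true 2)

  digitProduct-vanishes : ∀ j r → 2 + r ≤ 2 ^ j → digitProduct j r ≡ false
  digitProduct-vanishes j r 2+r≤2^j with digitProduct j r in Π≡
  ... | false = refl
  ... | true with digitProduct⇒a₀ j r 2+r≤2^j Π≡
  ...   | ()

  -- With p = 2^j, diff p (p m + r) = digitProduct j r ∧ diff 1 m vanishes unless r = p - 1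
  -- and m ∉ {2, 3}; on p ≤ x ≤ 5p - 2 that leaves only x = 2p - 1.
  diff-exceptional : ∀ j x → 2 ^ j ≤ x → x + 2 ≤ 5 * 2 ^ j → suc x ≢ 2 ^ j + 2 ^ j → diff (2 ^ j) x ≡ false
  diff-exceptional j x p≤x x+2≤5p x≢2p-1 =
    trans (cong₂ diff (sym (*-identityʳ p)) x≡pm+r)
          (trans (diff-dyadic j (x div p) r r<p) (vanish (x div p) x≡pm+r))
    where
    p = 2 ^ j
    instance
      p≢0 : NonZero p
      p≢0 = m^n≢0 2 j
    r = x % p
    r<p : r < p
    r<p = m%n<n x p
    x≡pm+r : x ≡ p * (x div p) + r
    x≡pm+r = trans (m≡m%n+[m/n]*n x p) (trans (+-comm r _) (cong (_+ r) (*-comm (x div p) p)))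
    vanish : ∀ m → x ≡ p * m + r → digitProduct j r ∧ diff 1 m ≡ false
    vanish 0 x≡ = ⊥-elim (<⇒≱ (subst (_< p) (sym (trans x≡ (cong (_+ r) (*-zeroʳ p)))) r<p) p≤x)
    vanish 1 x≡ = cong (_∧ diff 1 1) (digitProduct-vanishes j r (≤∧≢⇒< r<p r≢p-1))
      where
      r≢p-1 : suc r ≢ p
      r≢p-1 1+r≡p =
        x≢2p-1 (trans (cong suc x≡) (trans (sym (+-suc (p * 1) r)) (cong₂ _+_ (*-identityʳ p) 1+r≡p)))
    vanish 2 _  = trans (cong (digitProduct j r ∧_) diff-1-2) (∧-zeroʳ _)
    vanish 3 _  = trans (cong (digitProduct j r ∧_) diff-1-3) (∧-zeroʳ _)
    vanish 4 x≡ = cong (_∧ diff 1 4) (digitProduct-vanishes j r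
      (+-cancelˡ-≤ (p * 4) (2 + r) p (subst₂ _≤_ (trans (cong (_+ 2) x≡) (rearrange p r)) (five p) x+2≤5p)))
      where
      rearrange : ∀ p r → (p * 4 + r) + 2 ≡ p * 4 + (2 + r)
      rearrange = solve-∀
      five : ∀ p → 5 * p ≡ p * 4 + p
      five = solve-∀
    vanish (suc (suc (suc (suc (suc k))))) x≡ =
      ⊥-elim (<⇒≱ (subst (5 * p <_) (cong (_+ 2) (sym (trans x≡ (rearrange p k r))))
                        (<-≤-trans (m<m+n (5 * p) (z<s {1})) (+-monoˡ-≤ 2 (m≤m+n (5 * p) (p * k + r)))))
                  x+2≤5p)
      where
      rearrange : ∀ p k r → p * (5 + k) + r ≡ 5 * p + (p * k + r)
      rearrange = solve-∀

  C₂-exceptional-window : ∀ N j L → 2 ^ j ≤ L → L + 1 ≤ 4 * 2 ^ j → (2 ^ j + 2 ^ j) + L ≤ N → L ∸ 2 ≤ C₂ s N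
  C₂-exceptional-window N j zero    p≤0 _ _ = ⊥-elim (<⇒≱ (1≤2^ j) p≤0)
  C₂-exceptional-window N j (suc M) p≤L L+1≤4p 2p+L≤N =
    ≤-trans (z+2≡k⇒k∸2≤∣z∣ (corr s M p (p + p)) (suc M) (zsum-sgn-one-exception (suc M) a b a<L b-a others))
            (corr≤C₂ s N M p (p + p) (m<m+n p (1≤2^ j)) (subst (_≤ N) (+-suc (p + p) M) 2p+L≤N))
    where
    p = 2 ^ j
    a = pred p
    1+a≡p : suc a ≡ p
    1+a≡p = suc-pred p {{m^n≢0 2 j}}
    b : ℕ → Bool
    b n = s (n + p) xor s (n + (p + p))
    b≡diff : ∀ n → b n ≡ diff p (n + p)
    b≡diff n = cong (λ m → s (n + p) xor s m) (sym (+-assoc n p p))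
    a<L : a < suc M
    a<L = subst (_≤ suc M) (sym 1+a≡p) p≤L
    b-a : b a ≡ true
    b-a = begin
        b a
      ≡⟨ b≡diff a ⟩
        diff p (a + p)
      ≡⟨ cong₂ diff (sym (*-identityʳ p)) (trans (+-comm a p) (cong (_+ a) (sym (*-identityʳ p)))) ⟩
        diff (p * 1) (p * 1 + a)
      ≡⟨ diff-dyadic j 1 a (≤-reflexive 1+a≡p) ⟩
        digitProduct j a ∧ diff 1 1
      ≡⟨ cong₂ _∧_ (digitProduct-ones refl j a 1+a≡p) diff-1-1 ⟩
        true
      ∎
      where open ≡-Reasoning
    others : ∀ n → n < suc M → n ≢ a → b n ≡ false
    others n n<L n≢a = trans (b≡diff n) (diff-exceptional j (n + p) (m≤n+m p n) n+p+2≤5p 1+n+p≢2p)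
      where
      n+p+2≤5p : n + p + 2 ≤ 5 * p
      n+p+2≤5p = subst₂ _≤_ (swap n p) (four+one p)
        (+-monoˡ-≤ p (≤-trans (subst (n + 2 ≤_) (+-suc M 1) (+-monoˡ-≤ 2 (≤-pred n<L))) L+1≤4p))
        where
        swap : ∀ n p → (n + 2) + p ≡ n + p + 2
        swap = solve-∀
        four+one : ∀ p → 4 * p + p ≡ 5 * p
        four+one = solve-∀
      1+n+p≢2p : suc (n + p) ≢ p + p
      1+n+p≢2p e = n≢a (suc-injective (trans (+-cancelʳ-≡ p (suc n) p e) (sym 1+a≡p)))

  C₂-exceptional-at-scale : ∀ N j → 3 * 2 ^ j < N → N ≤ 6 * 2 ^ j → N < (C₂ s N + 2) * 3
  C₂-exceptional-at-scale N j 3p<N N≤6p with exceptional-length N (2 ^ j) 3p<N N≤6p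
  ... | L , p≤L , L+1≤4p , 2p+L≤N , N<3L =
    <-≤-trans N<3L (*-monoˡ-≤ 3 (subst (L ≤_) (+-comm 2 (C₂ s N))
      (≤-trans (m≤n+m∸n L 2) (+-monoʳ-≤ 2 (C₂-exceptional-window N j L p≤L L+1≤4p 2p+L≤N)))))

  C₂-exceptional : ∀ N → 6 ≤ N → N < (C₂ s N + 2) * 3
  C₂-exceptional (suc N) 6≤1+N with dyadic-scale 3 z<s N (≤-trans (m≤m+n 3 2) (≤-pred 6≤1+N))
  ... | j , lower , upper = C₂-exceptional-at-scale (suc N) j (s≤s (subst (_≤ N) (*-comm (2 ^ j) 3) lower))
                                                             (subst (suc N ≤_) (six (2 ^ j)) upper)
    where
    six : ∀ p → (2 * p) * 3 ≡ 6 * p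
    six = solve-∀

-- For ℓ = 0 the series R is a constant r; apart from the exceptional case the window
-- constant K = s₀ + s₁ satisfies the hypotheses of diff-window.
unit-period-start : ∀ a₀ a₁ r s₀ → s₀ ≡ r xor (a₀ ∧ s₀) →
  let s₁ = r xor (a₁ ∧ s₀) ; s₂ = r xor (a₀ ∧ s₁) in
  (a₀ ≡ false × a₁ ≡ true × r ≡ true) ⊎ (s₀ xor s₁ ≡ a₀ ∧ (s₀ xor s₁) × s₁ xor s₂ ≡ a₁ ∧ (s₀ xor s₁))
unit-period-start false false false false _  = inj₂ (refl , refl)
unit-period-start false false false true  ()
unit-period-start false false true  false ()
unit-period-start false false true  true  _  = inj₂ (refl , refl)
unit-period-start false true  false false _  = inj₂ (refl , refl)
unit-period-start false true  false true  ()
unit-period-start false true  true  false ()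
unit-period-start false true  true  true  _  = inj₁ (refl , refl , refl)
unit-period-start true  false false false _  = inj₂ (refl , refl)
unit-period-start true  false false true  _  = inj₂ (refl , refl)
unit-period-start true  false true  false ()
unit-period-start true  false true  true  ()
unit-period-start true  true  false false _  = inj₂ (refl , refl)
unit-period-start true  true  false true  _  = inj₂ (refl , refl)
unit-period-start true  true  true  false ()
unit-period-start true  true  true  true  ()

unit-period-bound : ∀ (s R : ℕ → Bool) a₀ a₁ →
                    (∀ k → s (k + k) ≡ R (k + k) xor (a₀ ∧ s k)) →
                    (∀ k → s (suc (k + k)) ≡ R (suc (k + k)) xor (a₁ ∧ s k)) →
                    (∀ d → R (1 + d) ≡ R d) →
                    ∀ N → 6 ≤ N → N < (C₂ s N + 2) * 3
unit-period-bound s R a₀ a₁ s-even s-odd R-periodic with unit-period-start a₀ a₁ (R 0) (s 0) (s-even 0)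
... | inj₁ (refl , refl , R₀) = Exceptional.C₂-exceptional s R s-even s-odd R-periodic R₀
... | inj₂ (start₀ , start₁) =
  Dyadic.C₂-generic s R a₀ a₁ 1 s-even s-odd R-periodic (s 0 xor s 1) diff₀ diff₁ ≤-refl
  where
  R-constant : ∀ n → R n ≡ R 0
  R-constant zero    = refl
  R-constant (suc n) = trans (R-periodic n) (R-constant n)
  s₁ : s 1 ≡ R 0 xor (a₁ ∧ s 0)
  s₁ = trans (s-odd 0) (cong (_xor (a₁ ∧ s 0)) (R-constant 1))
  s₂ : s 2 ≡ R 0 xor (a₀ ∧ s 1)
  s₂ = trans (s-even 1) (cong (_xor (a₀ ∧ s 1)) (R-constant 2))
  diff₀ : s 0 xor s 1 ≡ a₀ ∧ (s 0 xor s 1)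
  diff₀ = subst (λ x → s 0 xor x ≡ a₀ ∧ (s 0 xor x)) (sym s₁) start₀
  diff₁ : s 1 xor s 2 ≡ a₁ ∧ (s 0 xor s 1)
  diff₁ = trans (cong (s 1 xor_) s₂)
                (subst (λ x → x xor (R 0 xor (a₀ ∧ x)) ≡ a₁ ∧ (s 0 xor x)) (sym s₁) start₁)

even-period-bound : ∀ s ℓ f a₁ a₀ → DegBelow f (2 ^ suc ℓ) → (∀ n → hEval (suc ℓ) a₁ a₀ f s n ≡ false) →
                    ∀ N → 2 * (2 + 2 ^ suc ℓ) ≤ N → N < (C₂ s N + 2) * (2 + 2 ^ suc ℓ)
even-period-bound s ℓ f a₁ a₀ deg-f root = C₂-generic (diff t 0) diff₀ diff₁ (1≤2^ (suc ℓ))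
  where
  open Recurrence s (suc ℓ) f a₁ a₀ deg-f root
  open Dyadic s R a₀ a₁ T s-even s-odd R-periodic
  t = 2 ^ ℓ
  T≡t+t : T ≡ t + t
  T≡t+t = 2^-suc ℓ
  period : Period (t + t)
  period m = trans (cong R (trans (+-comm m (t + t)) (cong (_+ m) (sym T≡t+t)))) (R-periodic m)
  diff₀ : diff T 0 ≡ a₀ ∧ diff t 0
  diff₀ = subst (λ D → diff D 0 ≡ a₀ ∧ diff t 0) (sym T≡t+t) (proj₁ (diff-double t period 0))
  diff₁ : diff T 1 ≡ a₁ ∧ diff t 0
  diff₁ = subst (λ D → diff D 1 ≡ a₁ ∧ diff t 0) (sym T≡t+t) (proj₂ (diff-double t period 0))

C₂-bound : ∀ s ℓ f a₁ a₀ → DegBelow f (2 ^ ℓ) → (∀ n → hEval ℓ a₁ a₀ f s n ≡ false) →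
           ∀ N → 2 * (2 + 2 ^ ℓ) ≤ N → N < (C₂ s N + 2) * (2 + 2 ^ ℓ)
C₂-bound s zero    f a₁ a₀ deg-f root = unit-period-bound s R a₀ a₁ s-even s-odd R-periodic
  where open Recurrence s zero f a₁ a₀ deg-f root
C₂-bound s (suc ℓ) = even-period-bound s ℓ

-- The hypothesis (a₁, a₀) ≠ (0, 0) is not needed: in that case R = G, so s is 2^ℓ-periodic.
theorem2 : (s : ℕ → Bool) (ℓ : ℕ) (f : PS) (a₁ a₀ : Bool) →
    DegBelow f (2 ^ ℓ) →
    ¬ (a₁ ≡ false × a₀ ≡ false) →
    (∀ n → hEval ℓ a₁ a₀ f s n ≡ false) →
    ∀ N → 2 ^ (ℓ + 1) + 4 ≤ N →
    (+ C₂ s N / 1) > ((+ N / (2 + 2 ^ ℓ)) - (+ 2 / 1))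
theorem2 s ℓ f a₁ a₀ deg-f _ root N N-large =
  ℚ-lower-bound (C₂ s N) N (1 + 2 ^ ℓ) (C₂-bound s ℓ f a₁ a₀ deg-f root N (subst (_≤ N) N-bound N-large))
  where
  N-bound : 2 ^ (ℓ + 1) + 4 ≡ 2 * (2 + 2 ^ ℓ)
  N-bound = trans (cong (λ e → 2 ^ e + 4) (+-comm ℓ 1)) (double (2 ^ ℓ))
    where
    double : ∀ t → 2 * t + 4 ≡ 2 * (2 + t)
    double = solve-∀
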